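{- Let $\mathcal{H}\subseteq 2^{[n]}\setminus\{\emptyset\}$ be a hypergraph with $\mathcal{H}\cap\mathcal{H}^t=\emptyset$. Then for every $k\in\mathbb{Z}_+$, \[ N(k)=\{x\in\mathbb{Z}_+^n : m(x)=k,\ M(x)\notin\mathcal{H}^t,\ \mathcal{H}(x)\cap\mathcal{H}(x)^t\neq\emptyset\}. \]
   Context: Hypergraph NIM $\mathrm{NIM}_{\mathcal{H}}$: positions are $x\in\mathbb{Z}_+^n$; $x\to x'$ is a move iff $x\ge x'$ componentwise and $\{i: x'_i<x_i\}\in\mathcal{H}$. For a hypergraph $\mathcal{F}$, $\mathcal{F}^t=\{T\subseteq[n]: T\cap F\neq\emptyset\ \forall F\in\mathcal{F}\}$ is its family of transversals. For $S\subseteq[n]$, $\mathcal{H}_S=\{H\in\mathcal{H}: H\subseteq S\}$. For a position $x$: $m(x)=\min_i x_i$, $M(x)=\{i: x_i=m(x)\}$, and $\mathcal{H}(x)=\mathcal{H}_{[n]\setminus M(x)}$ (its transversal family $\mathcal{H}(x)^t$ is taken in the same sense). For $k\in\mathbb{Z}_+$: $P(k)=\{x: m(x)=k,\ M(x)\in\mathcal{H}^t\}$ and $N(k)=\{x\in\mathbb{Z}_+^n: \text{there is a move } x\to x' \text{ with } x'\in P(k)\}$. -}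

module Defs where

open import Data.Nat using (ℕ; zero; suc; _⊓_; _≤_; _<_)
open import Data.Nat.Properties using (_≟_; _<?_)
open import Data.Fin using (Fin; zero; suc)
open import Data.Fin.Subset using (Subset; _∩_; ∁; Nonempty; inside; outside)
open import Data.Fin.Subset.Properties using (_⊆?_)
open import Data.Vec using (tabulate)
open import Data.Bool using (Bool; true; false; _∧_; if_then_else_)
open import Data.Product using (Σ; _×_; ∃)
open import Relation.Binary.PropositionalEquality using (_≡_)
open import Relation.Nullary using (does)
open import Function using (_∘_)

Hypergraph : ℕ → Set
Hypergraph n = Subset n → Bool

Position : ℕ → Set
Position n = Fin n → ℕ

IsTransversal : ∀ {n} → Hypergraph n → Subset n → Set
IsTransversal F T = ∀ E → F E ≡ true → Nonempty (T ∩ E)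

restrict : ∀ {n} → Hypergraph n → Subset n → Hypergraph n
restrict H S E = H E ∧ does (E ⊆? S)

-- m(x) = min_i x_i  (junk value 0 when n = 0; the theorem assumes n ≥ 1)
m : ∀ {n} → Position n → ℕ
m {zero} _ = 0
m {suc zero} x = x zero
m {suc (suc n)} x = x zero ⊓ m (x ∘ suc)

M : ∀ {n} → Position n → Subset n
M x = tabulate (λ i → if does (x i ≟ m x) then inside else outside)

Hx : ∀ {n} → Hypergraph n → Position n → Hypergraph n
Hx H x = restrict H (∁ (M x))

Move : ∀ {n} → Hypergraph n → Position n → Position n → Set
Move H x x' = (∀ i → x' i ≤ x i)
            × H (tabulate (λ i → does (x' i <? x i))) ≡ true

P : ∀ {n} → Hypergraph n → ℕ → Position n → Set
P H k x = m x ≡ k × IsTransversal H (M x)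

N : ∀ {n} → Hypergraph n → ℕ → Position n → Set
N H k x = ∃ λ x' → Move H x x' × P H k x'

{-# OPTIONS --safe #-}
-- A move x → x' into P(k) cannot lower the minimum: otherwise every coordinate of
-- M(x') is lowered, so the edge E of the move contains the transversal M(x') and is
-- itself a transversal, which H ∩ H^t = ∅ forbids. Hence m(x) = k, the lowered edge E
-- avoids M(x), and M(x') ⊆ M(x) ∪ E. Conversely, lowering an edge E avoiding M(x)
-- down to m(x) yields M(x') ⊇ M(x) ∪ E. Both directions are then closed by the
-- observation that S ∪ T is a transversal of H iff T is a transversal of H_{∁S}.
module Submission where

open import Defs
open import Data.Nat using (ℕ; NonZero; suc; _≤_; _<_; _<?_)
open import Data.Nat.Properties
  using (_≟_; ≤-refl; ≤-trans; ≤-antisym; ≤-reflexive; <-≤-trans; <-irrefl; ≤∧≢⇒<; ≮⇒≥;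
         m⊓n≤m; m⊓n≤n; ⊓-sel; ⊓-glb)
open import Data.Fin using (Fin; zero; suc)
open import Data.Fin.Subset using (Subset; Nonempty; _∈_; _∉_; _∪_; ∁; _⊆_)
open import Data.Fin.Subset.Properties
  using (_∈?_; x∈p∩q⁺; x∈p∩q⁻; x∈p∪q⁺; x∈p∪q⁻; x∉p⇒x∈∁p; x∈∁p⇒x∉p; _⊆?_)
open import Data.Fin.Properties using (any?)
open import Data.Vec using (lookup; tabulate)
open import Data.Vec.Properties using ([]=⇒lookup; lookup⇒[]=; lookup∘tabulate; tabulate∘lookup; tabulate-cong)
open import Data.Bool using (Bool; true; false; if_then_else_)
open import Data.Product using (_×_; ∃; _,_)
open import Data.Sum using (_⊎_; inj₁; inj₂)
open import Function using (_∘_)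
open import Function.Bundles using (_⇔_; mk⇔)
open import Relation.Binary.PropositionalEquality using (_≡_; refl; sym; trans; subst)
open import Relation.Nullary using (¬_; Dec; yes; no; does; contradiction; _×-dec_)
open import Relation.Nullary.Decidable using (dec-true; dec-false)

private
  variable
    n : ℕ
    A : Set

m≤ : (x : Position (suc n)) (i : Fin (suc n)) → m x ≤ x i
m≤ {n = 0}     x zero    = ≤-refl
m≤ {n = suc _} x zero    = m⊓n≤m _ _
m≤ {n = suc _} x (suc i) = ≤-trans (m⊓n≤n _ _) (m≤ (x ∘ suc) i)

m-attained : (x : Position (suc n)) → ∃ λ i → x i ≡ m x
m-attained {n = 0}     x = zero , refl
m-attained {n = suc _} x with ⊓-sel (x zero) (m (x ∘ suc))
... | inj₁ eq = zero , sym eq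
... | inj₂ eq with m-attained (x ∘ suc)
...   | i , xi≡m = suc i , trans xi≡m (sym eq)

m-glb : (x : Position (suc n)) {k : ℕ} → (∀ i → k ≤ x i) → k ≤ m x
m-glb {n = 0}     x k≤x = k≤x zero
m-glb {n = suc _} x k≤x = ⊓-glb (k≤x zero) (m-glb (x ∘ suc) (k≤x ∘ suc))

m-mono : (x y : Position (suc n)) → (∀ i → y i ≤ x i) → m y ≤ m x
m-mono x y y≤x = m-glb x (λ i → ≤-trans (m≤ y i) (y≤x i))

does-true⇒ : (a? : Dec A) → does a? ≡ true → A
does-true⇒ (yes a) _ = a

∈-tabulate⁺ : (f : Fin n → Bool) {i : Fin n} → f i ≡ true → i ∈ tabulate f
∈-tabulate⁺ f {i} fi = lookup⇒[]= i _ (trans (lookup∘tabulate f i) fi)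

∈-tabulate⁻ : (f : Fin n → Bool) {i : Fin n} → i ∈ tabulate f → f i ≡ true
∈-tabulate⁻ f {i} i∈ = trans (sym (lookup∘tabulate f i)) ([]=⇒lookup i∈)

if-true-false : (b : Bool) → (if b then true else false) ≡ b
if-true-false true  = refl
if-true-false false = refl

∈M⁺ : (x : Position n) {i : Fin n} → x i ≡ m x → i ∈ M x
∈M⁺ x {i} xi≡m = ∈-tabulate⁺ _ (trans (if-true-false _) (dec-true (x i ≟ m x) xi≡m))

∈M⁻ : (x : Position n) {i : Fin n} → i ∈ M x → x i ≡ m x
∈M⁻ x {i} i∈M = does-true⇒ (x i ≟ m x) (trans (sym (if-true-false _)) (∈-tabulate⁻ _ i∈M))

Decreased : Position n → Position n → Subset n
Decreased x y = tabulate (λ i → does (y i <? x i))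

∈Decreased⁺ : (x y : Position n) {i : Fin n} → y i < x i → i ∈ Decreased x y
∈Decreased⁺ x y {i} yi<xi = ∈-tabulate⁺ _ (dec-true (y i <? x i) yi<xi)

∈Decreased⁻ : (x y : Position n) {i : Fin n} → i ∈ Decreased x y → y i < x i
∈Decreased⁻ x y {i} i∈ = does-true⇒ (y i <? x i) (∈-tabulate⁻ _ i∈)

restrict⁺ : (H : Hypergraph n) {S E : Subset n} → H E ≡ true → E ⊆ S → restrict H S E ≡ true
restrict⁺ H {S} {E} HE E⊆S rewrite HE | dec-true (E ⊆? S) E⊆S = refl

restrict⁻ : (H : Hypergraph n) {S E : Subset n} → restrict H S E ≡ true → H E ≡ true × E ⊆ S
restrict⁻ H {S} {E} eq with H E | E ⊆? S
restrict⁻ H refl | true | yes E⊆S = refl , E⊆S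

IsTransversal-mono : (H : Hypergraph n) {S T : Subset n} → S ⊆ T → IsTransversal H S → IsTransversal H T
IsTransversal-mono H S⊆T trS E HE with trS E HE
... | i , i∈S∩E with x∈p∩q⁻ _ E i∈S∩E
...   | i∈S , i∈E = i , x∈p∩q⁺ (S⊆T i∈S , i∈E)

edge-avoiding⇒¬IsTransversal : (H : Hypergraph n) {S E : Subset n} → H E ≡ true
                              → (∀ {i} → i ∈ E → i ∉ S) → ¬ IsTransversal H S
edge-avoiding⇒¬IsTransversal H {S} {E} HE E∩S≡∅ trS with trS E HE
... | i , i∈S∩E with x∈p∩q⁻ S E i∈S∩E
...   | i∈S , i∈E = E∩S≡∅ i∈E i∈S

IsTransversal-∪⇒restrict : (H : Hypergraph n) (S T : Subset n)
                         → IsTransversal H (S ∪ T) → IsTransversal (restrict H (∁ S)) T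
IsTransversal-∪⇒restrict H S T trS∪T E HSE with restrict⁻ H HSE
... | HE , E⊆∁S with trS∪T E HE
...   | i , i∈S∪T∩E with x∈p∩q⁻ (S ∪ T) E i∈S∪T∩E
...     | i∈S∪T , i∈E with x∈p∪q⁻ S T i∈S∪T
...       | inj₁ i∈S = contradiction i∈S (x∈∁p⇒x∉p (E⊆∁S i∈E))
...       | inj₂ i∈T = i , x∈p∩q⁺ (i∈T , i∈E)

restrict⇒IsTransversal-∪ : (H : Hypergraph n) (S T : Subset n)
                         → IsTransversal (restrict H (∁ S)) T → IsTransversal H (S ∪ T)
restrict⇒IsTransversal-∪ H S T trT E HE with any? (λ i → (i ∈? S) ×-dec (i ∈? E))
... | yes (i , i∈S , i∈E) = i , x∈p∩q⁺ (x∈p∪q⁺ (inj₁ i∈S) , i∈E)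
... | no E∩S≡∅ with trT E (restrict⁺ H HE (λ i∈E → x∉p⇒x∈∁p (λ i∈S → E∩S≡∅ (_ , i∈S , i∈E))))
...   | i , i∈T∩E with x∈p∩q⁻ T E i∈T∩E
...     | i∈T , i∈E = i , x∈p∩q⁺ (x∈p∪q⁺ (inj₂ i∈T) , i∈E)

TransversalEdge : Hypergraph n → Set
TransversalEdge H = ∃ λ E → H E ≡ true × IsTransversal H E

M-below⊆Decreased : (x y : Position (suc n)) → m y < m x → M y ⊆ Decreased x y
M-below⊆Decreased x y my<mx {i} i∈My =
  ∈Decreased⁺ x y (subst (_< x i) (sym (∈M⁻ y i∈My)) (<-≤-trans my<mx (m≤ x i)))

m-preserved : (H : Hypergraph (suc n)) → (∀ E → H E ≡ true → ¬ IsTransversal H E)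
            → (x y : Position (suc n)) → Move H x y → IsTransversal H (M y) → m y ≡ m x
m-preserved H noTransversalEdge x y (y≤x , HD) trMy with m y ≟ m x
... | yes my≡mx = my≡mx
... | no  my≢mx = contradiction (IsTransversal-mono H (M-below⊆Decreased x y my<mx) trMy)
                                (noTransversalEdge (Decreased x y) HD)
  where my<mx = ≤∧≢⇒< (m-mono x y y≤x) my≢mx

Decreased-avoids-M : (x y : Position (suc n)) → m y ≡ m x → ∀ {i} → i ∈ Decreased x y → i ∉ M x
Decreased-avoids-M x y my≡mx {i} i∈D i∈Mx = <-irrefl refl (<-≤-trans (∈Decreased⁻ x y i∈D) xi≤yi)
  where xi≤yi = subst (_≤ y i) (trans my≡mx (sym (∈M⁻ x i∈Mx))) (m≤ y i)

M⊆M∪Decreased : (x y : Position (suc n)) → (∀ i → y i ≤ x i) → m y ≡ m x → M y ⊆ M x ∪ Decreased x y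
M⊆M∪Decreased x y y≤x my≡mx {i} i∈My with y i <? x i
... | yes yi<xi = x∈p∪q⁺ (inj₂ (∈Decreased⁺ x y yi<xi))
... | no  yi≮xi = x∈p∪q⁺ (inj₁ (∈M⁺ x xi≡mx))
  where xi≡mx = trans (≤-antisym (≮⇒≥ yi≮xi) (y≤x i)) (trans (∈M⁻ y i∈My) my≡mx)

N⇒ : (H : Hypergraph (suc n)) → (∀ E → H E ≡ true → ¬ IsTransversal H E)
   → {k : ℕ} (x : Position (suc n)) → N H k x
   → m x ≡ k × ¬ IsTransversal H (M x) × TransversalEdge (Hx H x)
N⇒ H noTransversalEdge x (y , (y≤x , HD) , my≡k , trMy) =
  trans (sym my≡mx) my≡k ,
  edge-avoiding⇒¬IsTransversal H HD (Decreased-avoids-M x y my≡mx) ,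
  Decreased x y ,
  restrict⁺ H HD (x∉p⇒x∈∁p ∘ Decreased-avoids-M x y my≡mx) ,
  IsTransversal-∪⇒restrict H (M x) (Decreased x y) (IsTransversal-mono H (M⊆M∪Decreased x y y≤x my≡mx) trMy)
  where my≡mx = m-preserved H noTransversalEdge x y (y≤x , HD) trMy

lower : Subset n → ℕ → Position n → Position n
lower E k x i = if lookup E i then k else x i

lower-≤ : (E : Subset (suc n)) (x : Position (suc n)) {k : ℕ} → k ≤ m x → ∀ i → lower E k x i ≤ x i
lower-≤ E x k≤m i with lookup E i
... | true  = ≤-trans k≤m (m≤ x i)
... | false = ≤-refl

lower-≥ : (E : Subset (suc n)) (x : Position (suc n)) {k : ℕ} → k ≤ m x → ∀ i → k ≤ lower E k x i
lower-≥ E x k≤m i with lookup E i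
... | true  = ≤-refl
... | false = ≤-trans k≤m (m≤ x i)

Decreased-lower : (E : Subset n) (x : Position n) {k : ℕ} → (∀ {i} → i ∈ E → k < x i)
                → Decreased x (lower E k x) ≡ E
Decreased-lower E x {k} k<E = trans (tabulate-cong lowered⇔∈E) (tabulate∘lookup E)
  where
  lowered⇔∈E : ∀ i → does (lower E k x i <? x i) ≡ lookup E i
  lowered⇔∈E i with lookup E i in i∈E
  ... | true  = dec-true (k <? x i) (k<E (lookup⇒[]= i E i∈E))
  ... | false = dec-false (x i <? x i) (<-irrefl refl)

m-lower : (E : Subset (suc n)) (x : Position (suc n)) → m (lower E (m x) x) ≡ m x
m-lower E x with m-attained x
... | j , xj≡m = ≤-antisym (≤-trans (m≤ (lower E (m x) x) j) (≤-trans (lower-≤ E x ≤-refl j) (≤-reflexive xj≡m)))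
                           (m-glb (lower E (m x) x) (lower-≥ E x ≤-refl))

M∪E⊆M-lower : (E : Subset (suc n)) (x : Position (suc n)) → M x ∪ E ⊆ M (lower E (m x) x)
M∪E⊆M-lower E x {i} i∈M∪E = ∈M⁺ (lower E (m x) x) (trans (lowered-to-min (x∈p∪q⁻ (M x) E i∈M∪E)) (sym (m-lower E x)))
  where
  lowered-to-min : i ∈ M x ⊎ i ∈ E → lower E (m x) x i ≡ m x
  lowered-to-min i∈M⊎E with lookup E i in i∈E | i∈M⊎E
  ... | true  | _         = refl
  ... | false | inj₁ i∈M  = ∈M⁻ x i∈M
  ... | false | inj₂ i∈E' = contradiction (trans (sym i∈E) ([]=⇒lookup i∈E')) λ ()

⇒N : (H : Hypergraph (suc n)) (x : Position (suc n)) → TransversalEdge (Hx H x) → N H (m x) x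
⇒N H x (E , HxE , trE) with restrict⁻ H HxE
... | HE , E⊆∁M = lower E (m x) x , (lower-≤ E x ≤-refl , HD) , m-lower E x ,
                  IsTransversal-mono H (M∪E⊆M-lower E x) (restrict⇒IsTransversal-∪ H (M x) E trE)
  where
  E-above-min : ∀ {i} → i ∈ E → m x < x i
  E-above-min {i} i∈E = ≤∧≢⇒< (m≤ x i) (λ m≡xi → x∈∁p⇒x∉p (E⊆∁M i∈E) (∈M⁺ x (sym m≡xi)))
  HD : H (Decreased x (lower E (m x) x)) ≡ true
  HD = subst (λ D → H D ≡ true) (sym (Decreased-lower E x E-above-min)) HE

mainTheorem5 : (n : ℕ) → .{{_ : NonZero n}} → (H : Hypergraph n)
    → (∀ E → H E ≡ true → Nonempty E)
    → (∀ E → H E ≡ true → ¬ IsTransversal H E)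
    → (k : ℕ) → (x : Position n)
    → N H k x ⇔ (m x ≡ k × ¬ IsTransversal H (M x)
    × ∃ λ E → Hx H x E ≡ true × IsTransversal (Hx H x) E)
mainTheorem5 (suc n) H _ noTransversalEdge k x =
  mk⇔ (N⇒ H noTransversalEdge x) (λ where (refl , _ , transversalEdge) → ⇒N H x transversalEdge)
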